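{- Let $L_0,L_1,\ldots$ be a uniform sequence of supersolvable geometric lattices (with accompanying data $\iota_n$, $\theta_s$, $t_n$ as in the context). Then for each $n\ge0$ the geometric lattice $L_n$ is supersolvable, i.e., it has a maximal chain $\hat0=x_0\lessdot x_1\lessdot\cdots\lessdot x_n=\hat1$ consisting of modular elements.
   Context: A finite lattice $L$ is semimodular if it is graded with rank function $\rho$ and $\rho(p)+\rho(q)\ge\rho(p\vee q)+\rho(p\wedge q)$ for all $p,q$; geometric if semimodular and every element is a join of atoms. An element $p$ of a semimodular lattice is modular if $\rho(p)+\rho(q)=\rho(p\vee q)+\rho(p\wedge q)$ for all $q$. A semimodular lattice is supersolvable if it has a maximal chain of modular elements. A uniform sequence of supersolvable geometric lattices is a sequence of finite geometric lattices $L_0,L_1,\ldots$ such that each $L_n$ has rank $n$ and $[a,\hat1_{L_n}]\cong L_{n-1}$ for every atom $a\in L_n$, together with fixed isomorphisms $\theta_s:[s,\hat1_{L_n}]\to L_{n-1}$ for each atom $s\in L_n$ and fixed embeddings (isomorphisms onto their images) $\iota_n:L_n\to L_{n+1}$ satisfying: (i) $\iota_{n-1}(\theta_s(x))=\theta_{\iota_n(s)}(\iota_n(x))$ for every atom $s\in L_n$ and every $x\in[s,\hat1_{L_n}]$; (ii) the image of $\iota_n$ is $[\hat0_{L_{n+1}},t_n]$ for some modular coatom $t_n\in L_{n+1}$. -}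

module Defs where

open import Level using (Level; _⊔_) renaming (suc to lsuc)
open import Data.Nat using (ℕ; zero; suc; _+_) renaming (_≤_ to _≤ℕ_)
open import Data.Fin using (Fin)
open import Data.List using (List; foldr)
open import Data.List.Relation.Unary.All using (All)
open import Data.Product using (Σ; ∃; _×_; _,_)
open import Relation.Nullary using (¬_)
open import Relation.Binary using (Decidable)
open import Relation.Binary.PropositionalEquality using (_≡_)
open import Relation.Binary.Lattice.Bundles using (BoundedLattice)

private
  variable
    c ℓ₁ ℓ₂ : Level

record FiniteLattice c ℓ₁ ℓ₂ : Set (lsuc (c ⊔ ℓ₁ ⊔ ℓ₂)) where
  field
    boundedLattice : BoundedLattice c ℓ₁ ℓ₂
  open BoundedLattice boundedLattice public
  field
    size       : ℕ
    enum       : Fin size → Carrier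
    enum-onto  : ∀ x → ∃ λ i → enum i ≈ x
    _≤?_       : Decidable _≤_

module _ (L : FiniteLattice c ℓ₁ ℓ₂) where
  open FiniteLattice L

  _<ₗ_ : Carrier → Carrier → Set (ℓ₁ ⊔ ℓ₂)
  x <ₗ y = x ≤ y × ¬ (x ≈ y)

  _⋖_ : Carrier → Carrier → Set (c ⊔ ℓ₁ ⊔ ℓ₂)
  x ⋖ y = x <ₗ y × (∀ z → ¬ (x <ₗ z × z <ₗ y))

  Atom : Carrier → Set (c ⊔ ℓ₁ ⊔ ℓ₂)
  Atom a = ⊥ ⋖ a

  Coatom : Carrier → Set (c ⊔ ℓ₁ ⊔ ℓ₂)
  Coatom t = t ⋖ ⊤

  IsRankFunction : (Carrier → ℕ) → Set (c ⊔ ℓ₁ ⊔ ℓ₂)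
  IsRankFunction ρ = (ρ ⊥ ≡ 0) × (∀ x y → x ⋖ y → ρ y ≡ suc (ρ x))

  SemimodularWith : (Carrier → ℕ) → Set (c ⊔ ℓ₁ ⊔ ℓ₂)
  SemimodularWith ρ = IsRankFunction ρ × (∀ p q → ρ (p ∨ q) + ρ (p ∧ q) ≤ℕ ρ p + ρ q)

  Atomistic : Set (c ⊔ ℓ₁ ⊔ ℓ₂)
  Atomistic = ∀ x → ∃ λ (as : List Carrier) → All Atom as × (foldr _∨_ ⊥ as ≈ x)

  GeometricWith : (Carrier → ℕ) → Set (c ⊔ ℓ₁ ⊔ ℓ₂)
  GeometricWith ρ = SemimodularWith ρ × Atomistic

  ModularWith : (Carrier → ℕ) → Carrier → Set c
  ModularWith ρ p = ∀ q → ρ p + ρ q ≡ ρ (p ∨ q) + ρ (p ∧ q)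

  record MaximalChain : Set (c ⊔ ℓ₁ ⊔ ℓ₂) where
    field
      length : ℕ
      x      : ℕ → Carrier
      start  : x 0 ≈ ⊥
      end    : x length ≈ ⊤
      covers : ∀ i → suc i ≤ℕ length → x i ⋖ x (suc i)

  Supersolvable : Set (c ⊔ ℓ₁ ⊔ ℓ₂)
  Supersolvable = Σ (Carrier → ℕ) λ ρ → SemimodularWith ρ ×
                    Σ MaximalChain λ ch →
                      ∀ i → i ≤ℕ MaximalChain.length ch → ModularWith ρ (MaximalChain.x ch i)

record IntervalIso (L M : FiniteLattice c ℓ₁ ℓ₂) (s : FiniteLattice.Carrier L)
       : Set (c ⊔ ℓ₁ ⊔ ℓ₂) where
  private
    module L = FiniteLattice L
    module M = FiniteLattice M
  field
    to      : (x : L.Carrier) → s L.≤ x → M.Carrier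
    from    : M.Carrier → L.Carrier
    from-≥  : ∀ y → s L.≤ from y
    to-from : ∀ y → to (from y) (from-≥ y) M.≈ y
    from-to : ∀ x (p : s L.≤ x) → from (to x p) L.≈ x
    mono    : ∀ x (p : s L.≤ x) y (q : s L.≤ y) → x L.≤ y → to x p M.≤ to y q
    reflect : ∀ x (p : s L.≤ x) y (q : s L.≤ y) → to x p M.≤ to y q → x L.≤ y

record OrderEmbedding (L M : FiniteLattice c ℓ₁ ℓ₂) : Set (c ⊔ ℓ₁ ⊔ ℓ₂) where
  private
    module L = FiniteLattice L
    module M = FiniteLattice M
  field
    fun     : L.Carrier → M.Carrier
    mono    : ∀ x y → x L.≤ y → fun x M.≤ fun y
    reflect : ∀ x y → fun x M.≤ fun y → x L.≤ y

record UniformSequence c ℓ₁ ℓ₂ : Set (lsuc (c ⊔ ℓ₁ ⊔ ℓ₂)) where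
  field
    L         : ℕ → FiniteLattice c ℓ₁ ℓ₂
    ρ         : ∀ n → FiniteLattice.Carrier (L n) → ℕ
    geometric : ∀ n → GeometricWith (L n) (ρ n)
    rank      : ∀ n → ρ n (FiniteLattice.⊤ (L n)) ≡ n
    θ         : ∀ n (s : FiniteLattice.Carrier (L (suc n))) → Atom (L (suc n)) s →
                IntervalIso (L (suc n)) (L n) s
    ι         : ∀ n → OrderEmbedding (L n) (L (suc n))
    t         : ∀ n → FiniteLattice.Carrier (L (suc n))
    t-coatom  : ∀ n → Coatom (L (suc n)) (t n)
    t-modular : ∀ n → ModularWith (L (suc n)) (ρ (suc n)) (t n)
    image     : ∀ n (y : FiniteLattice.Carrier (L (suc n))) →
                (FiniteLattice._≤_ (L (suc n)) y (t n) →
                   ∃ λ x → FiniteLattice._≈_ (L (suc n)) (OrderEmbedding.fun (ι n) x) y)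
                × (∀ x → FiniteLattice._≈_ (L (suc n)) (OrderEmbedding.fun (ι n) x) y →
                   FiniteLattice._≤_ (L (suc n)) y (t n))
    compat    : ∀ n (s : FiniteLattice.Carrier (L (suc n))) (a : Atom (L (suc n)) s)
                (x : FiniteLattice.Carrier (L (suc n))) (p : FiniteLattice._≤_ (L (suc n)) s x)
                (a' : Atom (L (suc (suc n))) (OrderEmbedding.fun (ι (suc n)) s))
                (p' : FiniteLattice._≤_ (L (suc (suc n)))
                        (OrderEmbedding.fun (ι (suc n)) s) (OrderEmbedding.fun (ι (suc n)) x)) →
                FiniteLattice._≈_ (L (suc n))
                  (OrderEmbedding.fun (ι n) (IntervalIso.to (θ n s a) x p))
                  (IntervalIso.to (θ (suc n) (OrderEmbedding.fun (ι (suc n)) s) a') (OrderEmbedding.fun (ι (suc n)) x) p')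

{-# OPTIONS --safe #-}
-- Induction on n: the chain of L (n+1) is the image under ι of a modular maximal chain of
-- L n, which ends at ι ⊤ = t n, followed by ⊤. As ι maps L n onto [⊥, t n] it preserves
-- covers, joins, meets and ranks (a rank function of a finite lattice is unique). Modularity
-- transfers because t = t n is modular: for y ≤ t modular within [⊥, t], adding the modular
-- identities of t with q and with y ∨ q and of y with t ∧ q, and using
-- y ∨ (t ∧ q) ≤ t ∧ (y ∨ q), gives ρ y + ρ q ≤ ρ (y ∨ q) + ρ (y ∧ q); semimodularity gives
-- the reverse.
module Submission where

open import Defs
open import Level using (Level)
open import Function.Base using (_∘_; flip; _on_)
open import Data.Nat as ℕ using (ℕ; zero; suc; _+_; z≤n; s≤s)
import Data.Nat.Properties as ℕₚ
open import Data.Nat.Solver using (module +-*-Solver)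
open import Data.Fin using (Fin)
open import Data.Fin.Properties using (any?)
open import Data.Fin.Induction using (spo-wellFounded; spo-noetherian)
open import Data.Product using (Σ; ∃; ∃-syntax; _×_; _,_; proj₁; proj₂)
open import Data.Sum using (inj₁; inj₂)
open import Induction.WellFounded using (WellFounded; Acc; acc; module Subrelation)
open import Relation.Nullary using (¬_; Dec; yes; no)
open import Relation.Nullary.Decidable using (_×-dec_; ¬?)
open import Relation.Nullary.Negation using (contradiction)
open import Relation.Binary using (Decidable; _Preserves_⟶_; IsStrictPartialOrder)
import Relation.Binary.Construct.On as On
open import Relation.Binary.PropositionalEquality as ≡
  using (_≡_; _≗_; refl; module ≡-Reasoning)

private
  variable
    c ℓ₁ ℓ₂ : Level

ModularMaximalChain : (L : FiniteLattice c ℓ₁ ℓ₂) → (FiniteLattice.Carrier L → ℕ) → Set _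
ModularMaximalChain L ρ =
  Σ (MaximalChain L) λ ch →
    ∀ i → i ℕ.≤ MaximalChain.length ch → ModularWith L ρ (MaximalChain.x ch i)

-- The arithmetic of the modularity transfer, with y, q, T, J, W, P, M, A, B standing for
-- the ranks of y, q, t, y ∨ q, y ∧ q, t ∨ q, t ∧ q, y ∨ (t ∧ q), t ∧ (y ∨ q).
rank-inequality : ∀ {y q T J W P M A B} → T + q ≡ P + M → y + M ≡ A + W → T + J ≡ P + B →
                  A ℕ.≤ B → y + q ℕ.≤ J + W
rank-inequality {y} {q} {T} {J} {W} {P} {M} {A} {B} tq yM tJ A≤B =
  ℕₚ.+-cancelʳ-≤ (T + M) (y + q) (J + W) (begin
    (y + q) + (T + M) ≡⟨ solve 4 (λ y q T M → (y :+ q) :+ (T :+ M) := (y :+ M) :+ (T :+ q)) refl y q T M ⟩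
    (y + M) + (T + q) ≡⟨ ≡.cong₂ _+_ yM tq ⟩
    (A + W) + (P + M) ≤⟨ ℕₚ.+-monoˡ-≤ (P + M) (ℕₚ.+-monoˡ-≤ W A≤B) ⟩
    (B + W) + (P + M) ≡⟨ solve 4 (λ B W P M → (B :+ W) :+ (P :+ M) := (P :+ B) :+ (W :+ M)) refl B W P M ⟩
    (P + B) + (W + M) ≡⟨ ≡.cong (_+ (W + M)) (≡.sym tJ) ⟩
    (T + J) + (W + M) ≡⟨ solve 4 (λ T J W M → (T :+ J) :+ (W :+ M) := (J :+ W) :+ (T :+ M)) refl T J W M ⟩
    (J + W) + (T + M) ∎)
  where
  open ℕₚ.≤-Reasoning
  open +-*-Solver

module FiniteLatticeProperties (L : FiniteLattice c ℓ₁ ℓ₂) where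
  open FiniteLattice L renaming (refl to ≤-refl; trans to ≤-trans)
  open import Relation.Binary.Properties.Poset poset public using (_<_; <-respˡ-≈; <-respʳ-≈)
  open import Relation.Binary.Properties.Poset poset using (<-isStrictPartialOrder; ≤-dec⇒≈-dec)
  open import Relation.Binary.Lattice.Properties.BoundedLattice boundedLattice using (∨-zeroˡ)
  open import Relation.Binary.Lattice.Properties.JoinSemilattice joinSemilattice public
    using (∨-cong; ∨-assoc; ∨-comm; x≤y⇒x∨y≈y)
  open import Relation.Binary.Lattice.Properties.MeetSemilattice meetSemilattice public
    using (∧-cong; ∧-assoc; ∧-comm; y≤x⇒x∧y≈y)

  infix 4 _⋖ₗ_ _≈?_ _<?_

  _⋖ₗ_ : Carrier → Carrier → Set _
  _⋖ₗ_ = _⋖_ L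

  _≈?_ : Decidable _≈_
  _≈?_ = ≤-dec⇒≈-dec _≤?_

  _<?_ : Decidable _<_
  x <? y = (x ≤? y) ×-dec ¬? (x ≈? y)

  private
    index : Carrier → Fin size
    index x = proj₁ (enum-onto x)

    <-index : ∀ {x y} → x < y → enum (index x) < enum (index y)
    <-index {x} {y} x<y =
      <-respʳ-≈ (Eq.sym (proj₂ (enum-onto y))) (<-respˡ-≈ (Eq.sym (proj₂ (enum-onto x))) x<y)

    enum-<-isStrictPartialOrder : IsStrictPartialOrder (_≈_ on enum) (_<_ on enum)
    enum-<-isStrictPartialOrder = On.isStrictPartialOrder enum <-isStrictPartialOrder

  <-wellFounded : WellFounded _<_
  <-wellFounded = Subrelation.wellFounded <-index
    (On.wellFounded index (spo-wellFounded enum-<-isStrictPartialOrder))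

  >-wellFounded : WellFounded (flip _<_)
  >-wellFounded = Subrelation.wellFounded <-index
    (On.wellFounded index (spo-noetherian enum-<-isStrictPartialOrder))

  ⋖-respˡ-≈ : ∀ {x x′ y} → x ≈ x′ → x ⋖ₗ y → x′ ⋖ₗ y
  ⋖-respˡ-≈ x≈x′ (x<y , between) =
    <-respˡ-≈ x≈x′ x<y , λ z (x′<z , z<y) → between z (<-respˡ-≈ (Eq.sym x≈x′) x′<z , z<y)

  ⋖-respʳ-≈ : ∀ {x y y′} → y ≈ y′ → x ⋖ₗ y → x ⋖ₗ y′
  ⋖-respʳ-≈ y≈y′ (x<y , between) =
    <-respʳ-≈ y≈y′ x<y , λ z (x<z , z<y′) → between z (x<z , <-respʳ-≈ (Eq.sym y≈y′) z<y′)

  private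
    covers-if-none-between : ∀ {a b} → a < b → ¬ (∃ λ i → a < enum i × enum i < b) → a ⋖ₗ b
    covers-if-none-between a<b none = a<b , λ z (a<z , z<b) →
      let i , enum-i≈z = enum-onto z
      in none (i , <-respʳ-≈ (Eq.sym enum-i≈z) a<z , <-respˡ-≈ (Eq.sym enum-i≈z) z<b)

    between? : ∀ a b → Dec (∃ λ i → a < enum i × enum i < b)
    between? a b = any? (λ i → (a <? enum i) ×-dec (enum i <? b))

  cover-above : ∀ {a b} → a < b → ∃[ c ] a ⋖ₗ c × c ≤ b
  cover-above = go (<-wellFounded _)
    where
    go : ∀ {a b} → Acc _<_ b → a < b → ∃[ c ] a ⋖ₗ c × c ≤ b
    go {a} {b} (acc smaller) a<b with between? a b
    ... | no none = b , covers-if-none-between a<b none , ≤-refl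
    ... | yes (i , a<z , z<b) =
      let c , a⋖c , c≤z = go (smaller z<b) a<z in c , a⋖c , ≤-trans c≤z (proj₁ z<b)

  cover-below : ∀ {a b} → a < b → ∃[ d ] a ≤ d × d ⋖ₗ b
  cover-below {a} = go (>-wellFounded a)
    where
    go : ∀ {a b} → Acc (flip _<_) a → a < b → ∃[ d ] a ≤ d × d ⋖ₗ b
    go {a} {b} (acc larger) a<b with between? a b
    ... | no none = a , ≤-refl , covers-if-none-between a<b none
    ... | yes (i , a<z , z<b) =
      let d , z≤d , d⋖b = go (larger a<z) z<b in d , ≤-trans (proj₁ a<z) z≤d , d⋖b

  coatom⇒nontrivial : ∀ {t} → Coatom L t → ¬ ⊥ ≈ ⊤
  coatom⇒nontrivial ((t≤⊤ , t≉⊤) , _) ⊥≈⊤ =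
    t≉⊤ (antisym t≤⊤ (≤-trans (reflexive (Eq.sym ⊥≈⊤)) (minimum _)))

  rank-unique : ∀ {g h} → IsRankFunction L g → IsRankFunction L h →
                g Preserves _≈_ ⟶ _≡_ → h Preserves _≈_ ⟶ _≡_ → g ≗ h
  rank-unique {g} {h} (g-⊥ , g-⋖) (h-⊥ , h-⋖) g-cong h-cong x = go (<-wellFounded x)
    where
    open ≡-Reasoning
    go : ∀ {x} → Acc _<_ x → g x ≡ h x
    go {x} (acc smaller) with x ≈? ⊥
    ... | yes x≈⊥ = begin
      g x ≡⟨ g-cong x≈⊥ ⟩
      g ⊥ ≡⟨ ≡.trans g-⊥ (≡.sym h-⊥) ⟩
      h ⊥ ≡⟨ h-cong (Eq.sym x≈⊥) ⟩
      h x ∎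
    ... | no x≉⊥ = let d , _ , d⋖x = cover-below (minimum x , x≉⊥ ∘ Eq.sym) in begin
      g x       ≡⟨ g-⋖ d x d⋖x ⟩
      suc (g d) ≡⟨ ≡.cong suc (go (smaller (proj₁ d⋖x))) ⟩
      suc (h d) ≡⟨ ≡.sym (h-⋖ d x d⋖x) ⟩
      h x       ∎

  module RankFunction {ρ : Carrier → ℕ} (isRank : IsRankFunction L ρ) where

    ρ-⋖ : ∀ {x y} → x ⋖ₗ y → ρ y ≡ suc (ρ x)
    ρ-⋖ = proj₂ isRank _ _

    rank-zero⇒trivial : ρ ⊤ ≡ 0 → ⊥ ≈ ⊤
    rank-zero⇒trivial ρ⊤≡0 with ⊥ ≈? ⊤
    ... | yes ⊥≈⊤ = ⊥≈⊤
    ... | no ⊥≉⊤ = let _ , _ , d⋖⊤ = cover-below (minimum ⊤ , ⊥≉⊤) in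
      contradiction (≡.trans (≡.sym ρ⊤≡0) (ρ-⋖ d⋖⊤)) ℕₚ.0≢1+n

    nontrivial⇒ρ-cong : ¬ ⊥ ≈ ⊤ → ρ Preserves _≈_ ⟶ _≡_
    nontrivial⇒ρ-cong ⊥≉⊤ {x} {y} x≈y with x ≈? ⊤
    ... | yes x≈⊤ = let d , _ , d⋖⊤ = cover-below (minimum ⊤ , ⊥≉⊤) in
      ≡.trans (ρ-⋖ (⋖-respʳ-≈ (Eq.sym x≈⊤) d⋖⊤))
              (≡.sym (ρ-⋖ (⋖-respʳ-≈ (Eq.trans (Eq.sym x≈⊤) x≈y) d⋖⊤)))
    ... | no x≉⊤ = let _ , x⋖c , _ = cover-above (maximum x , x≉⊤) in
      ℕₚ.suc-injective (≡.trans (≡.sym (ρ-⋖ x⋖c)) (ρ-⋖ (⋖-respˡ-≈ x≈y x⋖c)))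

    ModularBelow : Carrier → Carrier → Set _
    ModularBelow t y = ∀ q → q ≤ t → ρ y + ρ q ≡ ρ (y ∨ q) + ρ (y ∧ q)

    module _ (ρ-cong : ρ Preserves _≈_ ⟶ _≡_) where

      ρ-mono : ρ Preserves _≤_ ⟶ ℕ._≤_
      ρ-mono = go (<-wellFounded _)
        where
        go : ∀ {a b} → Acc _<_ b → a ≤ b → ρ a ℕ.≤ ρ b
        go {a} {b} (acc smaller) a≤b with a ≈? b
        ... | yes a≈b = ℕₚ.≤-reflexive (ρ-cong a≈b)
        ... | no a≉b = let d , a≤d , d⋖b = cover-below (a≤b , a≉b) in
          ℕₚ.≤-trans (ℕₚ.m≤n⇒m≤1+n (go (smaller (proj₁ d⋖b)) a≤d)) (ℕₚ.≤-reflexive (≡.sym (ρ-⋖ d⋖b)))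

      ⊤-modular : ModularWith L ρ ⊤
      ⊤-modular q =
        ≡.cong₂ _+_ (ρ-cong (Eq.sym (∨-zeroˡ q))) (ρ-cong (Eq.sym (y≤x⇒x∧y≈y (maximum q))))

      modularBelow⇒modular : (∀ p q → ρ (p ∨ q) + ρ (p ∧ q) ℕ.≤ ρ p + ρ q) →
                             ∀ {t y} → ModularWith L ρ t → y ≤ t → ModularBelow t y →
                             ModularWith L ρ y
      modularBelow⇒modular submodular {t} {y} t-modular y≤t y-modularBelow q =
        ℕₚ.≤-antisym
          (rank-inequality
            (t-modular q)
            (≡.trans (y-modularBelow (t ∧ q) (x∧y≤x t q))
                     (≡.cong (ρ (y ∨ (t ∧ q)) +_) (ρ-cong y∧[t∧q]≈y∧q)))
            (≡.trans (t-modular (y ∨ q)) (≡.cong (_+ ρ (t ∧ (y ∨ q))) (ρ-cong t∨[y∨q]≈t∨q)))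
            (ρ-mono modular-inequality))
          (submodular y q)
        where
        y∧[t∧q]≈y∧q : y ∧ (t ∧ q) ≈ y ∧ q
        y∧[t∧q]≈y∧q = Eq.trans (Eq.sym (∧-assoc y t q))
                                (∧-cong (Eq.trans (∧-comm y t) (y≤x⇒x∧y≈y y≤t)) Eq.refl)
        t∨[y∨q]≈t∨q : t ∨ (y ∨ q) ≈ t ∨ q
        t∨[y∨q]≈t∨q = Eq.trans (Eq.sym (∨-assoc t y q))
                                (∨-cong (Eq.trans (∨-comm t y) (x≤y⇒x∨y≈y y≤t)) Eq.refl)
        modular-inequality : y ∨ (t ∧ q) ≤ t ∧ (y ∨ q)
        modular-inequality = ∨-least (∧-greatest y≤t (x≤x∨y y q))
                                     (∧-greatest (x∧y≤x t q) (≤-trans (x∧y≤y t q) (y≤x∨y y q)))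

  module Trivial (⊥≈⊤ : ⊥ ≈ ⊤) where

    private
      ≈⊥ : ∀ x → x ≈ ⊥
      ≈⊥ x = antisym (≤-trans (maximum x) (reflexive (Eq.sym ⊥≈⊤))) (minimum x)

    zero-isRank : IsRankFunction L (λ _ → 0)
    zero-isRank = refl , λ x y ((_ , x≉y) , _) →
      contradiction (Eq.trans (≈⊥ x) (Eq.sym (≈⊥ y))) x≉y

    zero-modularChain : ModularMaximalChain L (λ _ → 0)
    zero-modularChain =
      record { length = 0 ; x = λ _ → ⊥ ; start = Eq.refl ; end = ⊥≈⊤ ; covers = λ _ () } ,
      λ _ _ _ → refl

    supersolvable : Supersolvable L
    supersolvable = (λ _ → 0) , (zero-isRank , λ _ _ → z≤n) , zero-modularChain

ImageIsPrincipalIdeal : {L M : FiniteLattice c ℓ₁ ℓ₂} →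
                        OrderEmbedding L M → FiniteLattice.Carrier M → Set _
ImageIsPrincipalIdeal {M = M} ι t =
  ∀ y → (y ≤ t → ∃ λ x → OrderEmbedding.fun ι x ≈ y)
      × (∀ x → OrderEmbedding.fun ι x ≈ y → y ≤ t)
  where open FiniteLattice M

module PrincipalIdealEmbedding {L M : FiniteLattice c ℓ₁ ℓ₂} (ι : OrderEmbedding L M)
                               {t : FiniteLattice.Carrier M} (image : ImageIsPrincipalIdeal ι t) where
  private
    module L = FiniteLattice L
    module M = FiniteLattice M
    module Lₚ = FiniteLatticeProperties L
    module Mₚ = FiniteLatticeProperties M
  open OrderEmbedding ι renaming (fun to f)

  f-cong : f Preserves L._≈_ ⟶ M._≈_
  f-cong x≈y = M.antisym (mono _ _ (L.reflexive x≈y)) (mono _ _ (L.reflexive (L.Eq.sym x≈y)))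

  f-≤t : ∀ x → f x M.≤ t
  f-≤t x = proj₂ (image (f x)) x M.Eq.refl

  f-onto : ∀ {y} → y M.≤ t → ∃ λ x → f x M.≈ y
  f-onto {y} = proj₁ (image y)

  f-⊥ : f L.⊥ M.≈ M.⊥
  f-⊥ = let x , fx≈⊥ = f-onto (M.minimum t) in
    M.antisym (M.trans (mono _ _ (L.minimum x)) (M.reflexive fx≈⊥)) (M.minimum _)

  f-⊤ : f L.⊤ M.≈ t
  f-⊤ = let x , fx≈t = f-onto M.refl in
    M.antisym (f-≤t L.⊤) (M.trans (M.reflexive (M.Eq.sym fx≈t)) (mono _ _ (L.maximum x)))

  private
    reflect-≤ : ∀ {x u z} → f u M.≈ z → f x M.≤ z → x L.≤ u
    reflect-≤ fu≈z fx≤z = reflect _ _ (M.trans fx≤z (M.reflexive (M.Eq.sym fu≈z)))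

    reflect-≥ : ∀ {x u z} → f u M.≈ z → z M.≤ f x → u L.≤ x
    reflect-≥ fu≈z z≤fx = reflect _ _ (M.trans (M.reflexive fu≈z) z≤fx)

  f-∨ : ∀ x y → f (x L.∨ y) M.≈ f x M.∨ f y
  f-∨ x y with f-onto (M.∨-least (f-≤t x) (f-≤t y))
  ... | u , fu≈fx∨fy = M.antisym
    (M.trans (mono _ _ x∨y≤u) (M.reflexive fu≈fx∨fy))
    (M.∨-least (mono _ _ (L.x≤x∨y x y)) (mono _ _ (L.y≤x∨y x y)))
    where
    x∨y≤u : x L.∨ y L.≤ u
    x∨y≤u = L.∨-least (reflect-≤ fu≈fx∨fy (M.x≤x∨y _ _)) (reflect-≤ fu≈fx∨fy (M.y≤x∨y _ _))

  f-∧ : ∀ x y → f (x L.∧ y) M.≈ f x M.∧ f y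
  f-∧ x y with f-onto (M.trans (M.x∧y≤x (f x) (f y)) (f-≤t x))
  ... | u , fu≈fx∧fy = M.antisym
    (M.∧-greatest (mono _ _ (L.x∧y≤x x y)) (mono _ _ (L.x∧y≤y x y)))
    (M.trans (M.reflexive (M.Eq.sym fu≈fx∧fy)) (mono _ _ u≤x∧y))
    where
    u≤x∧y : u L.≤ x L.∧ y
    u≤x∧y = L.∧-greatest (reflect-≥ fu≈fx∧fy (M.x∧y≤x _ _)) (reflect-≥ fu≈fx∧fy (M.x∧y≤y _ _))

  f-< : ∀ {x y} → x Lₚ.< y → f x Mₚ.< f y
  f-< (x≤y , x≉y) =
    mono _ _ x≤y , λ fx≈fy → x≉y (L.antisym x≤y (reflect _ _ (M.reflexive (M.Eq.sym fx≈fy))))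

  f-<⁻¹ : ∀ {x y} → f x Mₚ.< f y → x Lₚ.< y
  f-<⁻¹ (fx≤fy , fx≉fy) = reflect _ _ fx≤fy , λ x≈y → fx≉fy (f-cong x≈y)

  f-⋖ : ∀ {x y} → x Lₚ.⋖ₗ y → f x Mₚ.⋖ₗ f y
  f-⋖ {x} {y} (x<y , between) = f-< x<y , λ z (fx<z , z<fy) →
    let w , fw≈z = f-onto (M.trans (proj₁ z<fy) (f-≤t y)) in
    between w ( f-<⁻¹ (Mₚ.<-respʳ-≈ (M.Eq.sym fw≈z) fx<z)
              , f-<⁻¹ (Mₚ.<-respˡ-≈ (M.Eq.sym fw≈z) z<fy))

  module _ {ρᴸ : L.Carrier → ℕ} {ρᴹ : M.Carrier → ℕ}
           (ρᴸ-isRank : IsRankFunction L ρᴸ) (ρᴸ-cong : ρᴸ Preserves L._≈_ ⟶ _≡_)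
           (ρᴹ-semimodular : SemimodularWith M ρᴹ) (ρᴹ-cong : ρᴹ Preserves M._≈_ ⟶ _≡_)
           (t-modular : ModularWith M ρᴹ t) where
    private
      module Rᴹ = Mₚ.RankFunction (proj₁ ρᴹ-semimodular)

    ρᴹ∘f≗ρᴸ : ρᴹ ∘ f ≗ ρᴸ
    ρᴹ∘f≗ρᴸ = Lₚ.rank-unique
      (≡.trans (ρᴹ-cong f-⊥) (proj₁ (proj₁ ρᴹ-semimodular)) , λ _ _ x⋖y → Rᴹ.ρ-⋖ (f-⋖ x⋖y))
      ρᴸ-isRank (λ x≈y → ρᴹ-cong (f-cong x≈y)) ρᴸ-cong

    f-modular : ∀ {x} → ModularWith L ρᴸ x → ModularWith M ρᴹ (f x)
    f-modular {x} x-modular =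
      Rᴹ.modularBelow⇒modular ρᴹ-cong (proj₂ ρᴹ-semimodular) t-modular (f-≤t x) modularBelow
      where
      open ≡-Reasoning
      ρᴹ-image : ∀ {w q} → f w M.≈ q → ρᴹ q ≡ ρᴸ w
      ρᴹ-image fw≈q = ≡.trans (ρᴹ-cong (M.Eq.sym fw≈q)) (ρᴹ∘f≗ρᴸ _)
      modularBelow : Rᴹ.ModularBelow t (f x)
      modularBelow q q≤t with f-onto q≤t
      ... | w , fw≈q = begin
        ρᴹ (f x) + ρᴹ q                 ≡⟨ ≡.cong₂ _+_ (ρᴹ∘f≗ρᴸ x) (ρᴹ-image fw≈q) ⟩
        ρᴸ x + ρᴸ w                     ≡⟨ x-modular w ⟩
        ρᴸ (x L.∨ w) + ρᴸ (x L.∧ w)     ≡⟨ ≡.cong₂ _+_ (ρᴹ-image f[x∨w]≈fx∨q) (ρᴹ-image f[x∧w]≈fx∧q) ⟨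
        ρᴹ (f x M.∨ q) + ρᴹ (f x M.∧ q) ∎
        where
        f[x∨w]≈fx∨q : f (x L.∨ w) M.≈ f x M.∨ q
        f[x∨w]≈fx∨q = M.Eq.trans (f-∨ x w) (Mₚ.∨-cong M.Eq.refl fw≈q)
        f[x∧w]≈fx∧q : f (x L.∧ w) M.≈ f x M.∧ q
        f[x∧w]≈fx∧q = M.Eq.trans (f-∧ x w) (Mₚ.∧-cong M.Eq.refl fw≈q)

    extend : Coatom M t → ModularMaximalChain L ρᴸ → ModularMaximalChain M ρᴹ
    extend t-coatom (chain , chain-modular) = lifted , lifted-modular
      where
      open MaximalChain chain
      y : ℕ → M.Carrier
      y i with i ℕ.≤? length
      ... | yes _ = f (x i)
      ... | no _ = M.⊤

      y-≤ : ∀ {i} → i ℕ.≤ length → y i ≡ f (x i)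
      y-≤ {i} i≤k with i ℕ.≤? length
      ... | yes _ = refl
      ... | no i≰k = contradiction i≤k i≰k

      y-top : y (suc length) ≡ M.⊤
      y-top with suc length ℕ.≤? length
      ... | yes k<k = contradiction k<k (ℕₚ.n≮n length)
      ... | no _ = refl

      y-covers : ∀ i → suc i ℕ.≤ suc length → y i Mₚ.⋖ₗ y (suc i)
      y-covers i (s≤s i≤k) with ℕₚ.m≤n⇒m<n∨m≡n i≤k
      ... | inj₁ i<k = ≡.subst₂ Mₚ._⋖ₗ_ (≡.sym (y-≤ i≤k)) (≡.sym (y-≤ i<k))
                                       (f-⋖ (covers i i<k))
      ... | inj₂ refl = ≡.subst₂ Mₚ._⋖ₗ_ (≡.sym (y-≤ i≤k)) (≡.sym y-top)
                                        (Mₚ.⋖-respˡ-≈ (M.Eq.sym (M.Eq.trans (f-cong end) f-⊤)) t-coatom)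

      lifted : MaximalChain M
      lifted = record
        { length = suc length
        ; x      = y
        ; start  = M.Eq.trans (M.Eq.reflexive (y-≤ z≤n)) (M.Eq.trans (f-cong start) f-⊥)
        ; end    = M.Eq.reflexive y-top
        ; covers = y-covers
        }

      lifted-modular : ∀ i → i ℕ.≤ suc length → ModularWith M ρᴹ (y i)
      lifted-modular i i≤k+1 with ℕₚ.m≤n⇒m<n∨m≡n i≤k+1
      ... | inj₁ (s≤s i≤k) = ≡.subst (ModularWith M ρᴹ) (≡.sym (y-≤ i≤k))
                                     (f-modular (chain-modular i i≤k))
      ... | inj₂ refl = ≡.subst (ModularWith M ρᴹ) (≡.sym y-top) (Rᴹ.⊤-modular ρᴹ-cong)

module UniformSequenceProperties (U : UniformSequence c ℓ₁ ℓ₂) where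
  open UniformSequence U
  private
    module Lₚ n = FiniteLatticeProperties (L n)

    isRank : ∀ n → IsRankFunction (L n) (ρ n)
    isRank n = proj₁ (proj₁ (geometric n))

  semimodular : ∀ n → SemimodularWith (L n) (ρ n)
  semimodular n = proj₁ (geometric n)

  ρ-cong : ∀ m → ρ (suc m) Preserves FiniteLattice._≈_ (L (suc m)) ⟶ _≡_
  ρ-cong m = Lₚ.RankFunction.nontrivial⇒ρ-cong (suc m) (isRank (suc m))
                                                (Lₚ.coatom⇒nontrivial (suc m) (t-coatom m))

  L₀-trivial : FiniteLattice._≈_ (L 0) (FiniteLattice.⊥ (L 0)) (FiniteLattice.⊤ (L 0))
  L₀-trivial = Lₚ.RankFunction.rank-zero⇒trivial 0 (isRank 0) (rank 0)

  extend : ∀ m {ρ′} → IsRankFunction (L m) ρ′ → ρ′ Preserves FiniteLattice._≈_ (L m) ⟶ _≡_ →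
           ModularMaximalChain (L m) ρ′ → ModularMaximalChain (L (suc m)) (ρ (suc m))
  extend m isRank′ ρ′-cong = PrincipalIdealEmbedding.extend (ι m) (image m)
    isRank′ ρ′-cong (semimodular (suc m)) (ρ-cong m) (t-modular m) (t-coatom m)

  -- ρ 0 need not respect ≈ on the one-point lattice L 0, so there the zero rank function is used.
  modularChain : ∀ m → ModularMaximalChain (L (suc m)) (ρ (suc m))
  modularChain zero    = extend 0 zero-isRank (λ _ → refl) zero-modularChain
    where open Lₚ.Trivial 0 L₀-trivial
  modularChain (suc m) = extend (suc m) (isRank (suc m)) (ρ-cong m) (modularChain m)

proposition3p14 : ∀ {c ℓ₁ ℓ₂ : Level} (U : UniformSequence c ℓ₁ ℓ₂) (n : ℕ) →
                  Supersolvable (UniformSequence.L U n)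
proposition3p14 U zero    = Trivial.supersolvable L₀-trivial
  where open UniformSequenceProperties U
        open FiniteLatticeProperties (UniformSequence.L U 0)
proposition3p14 U (suc m) = ρ (suc m) , semimodular (suc m) , modularChain m
  where open UniformSequence U
        open UniformSequenceProperties U
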